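{- Let $T=(V,E)$ be a finite unlabelled tree of size $n$. If $u_0,v_0\in V$ are not bisimilar, then $r(u_0,v_0)\le 2\log_2(|u_0|+|v_0|)$.
   Context: An unlabelled tree is a finite rooted directed tree (edges away from the root). For a node $u$, $|u|$ denotes the number of nodes of the subtree rooted at $u$. For $d\in\mathbb N$, write $u\xrightarrow{d}u'$ if there is a directed path of length $d$ from $u$ to $u'$. On a finite unlabelled directed graph $G=(V,E)$ define relations $\approx_k$: $u\approx_0 v$ for all $u,v$; and $u\approx_{k+1}v$ iff for all $d\in\mathbb N$, for every $u\xrightarrow{d}u'$ there is $v\xrightarrow{d}v'$ with $u'\approx_k v'$, and for every $v\xrightarrow{d}v'$ there is $u\xrightarrow{d}u'$ with $u'\approx_k v'$. Let $r(u,v)=\sup\{k\in\mathbb N\mid u\approx_k v\}\in\mathbb N\cup\{\infty\}$. Bisimilarity: $u,v$ are bisimilar if there is a relation $R\ni(u,v)$ such that for $(x,y)\in R$ every successor of $x$ is $R$-related to some successor of $y$ and vice versa. -}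

module Defs where

open import Data.Nat using (ℕ; zero; suc; _+_; _<_)
open import Data.Fin using (Fin; _≟_)
open import Data.Bool using (Bool; true; false; _∧_; if_then_else_)
open import Data.List using (List; map; upTo; allFin)
open import Data.Bool.ListAction using (any)
open import Data.Nat.ListAction using (sum)
open import Data.Product using (Σ; ∃; _×_; _,_)
open import Data.Unit using (⊤)
open import Relation.Nullary using (¬_; ⌊_⌋)
open import Relation.Binary.PropositionalEquality using (_≡_)

Adj : ℕ → Set
Adj n = Fin n → Fin n → Bool

module _ {n : ℕ} (adj : Adj n) where

  Edge : Fin n → Fin n → Set
  Edge u v = adj u v ≡ true

  data Path : ℕ → Fin n → Fin n → Set where
    here  : ∀ {u} → Path zero u u
    step  : ∀ {d u x w} → Edge u x → Path d x w → Path (suc d) u w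

  pathB : ℕ → Fin n → Fin n → Bool
  pathB zero    u w = ⌊ u ≟ w ⌋
  pathB (suc d) u w = any (λ x → adj u x ∧ pathB d x w) (allFin n)

  -- w is a descendant of u (u itself included): a path of length < n,
  -- which in an n-node tree covers all directed paths.
  descB : Fin n → Fin n → Bool
  descB u w = any (λ d → pathB d u w) (upTo n)

  size : Fin n → ℕ
  size u = sum (map (λ w → if descB u w then 1 else 0) (allFin n))

  Approx : ℕ → Fin n → Fin n → Set
  Approx zero    u v = ⊤
  Approx (suc k) u v =
    (∀ d u' → Path d u u' → Σ (Fin n) λ v' → Path d v v' × Approx k u' v') ×
    (∀ d v' → Path d v v' → Σ (Fin n) λ u' → Path d u u' × Approx k u' v')

  Bisimilar : Fin n → Fin n → Set₁
  Bisimilar u v =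
    Σ (Fin n → Fin n → Set) λ R → R u v ×
      (∀ x y → R x y →
        (∀ x' → Edge x x' → Σ (Fin n) λ y' → Edge y y' × R x' y') ×
        (∀ y' → Edge y y' → Σ (Fin n) λ x' → Edge x x' × R x' y'))

  -- Rooted directed tree (edges directed away from the root) with root r:
  -- no edge enters r, every other node has exactly one incoming edge,
  -- and every node is reachable from r.
  record IsRootedTree (r : Fin n) : Set where
    field
      root-no-parent : ∀ x → ¬ Edge x r
      parent         : ∀ v → ¬ v ≡ r → Σ (Fin n) λ p → Edge p v
      parent-unique  : ∀ v p q → Edge p v → Edge q v → p ≡ q
      reachable      : ∀ v → ∃ λ d → Path d r v

module Submission where

-- If r(u,v) = m + 2, unfolding ≈ twice gives descendants p, q of u, v at a common depth
-- with r(p,q) = m. Their ≈_{m+1}-partners, z below v for p and o below u for q, at the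
-- same depth, also have r(o,z) = m, and o ≠ p, z ≠ q. Distinct nodes at equal depth of a
-- tree have disjoint subtrees, so |p| + |o| ≤ |u| and |q| + |z| ≤ |v|: every two ranks at
-- least double |u| + |v|, whence 2^r(u,v) ≤ (|u| + |v|)². Conversely, if u ≈_k v with
-- 2^k > (|u| + |v|)², this bound forces u ≈_j v for all j ≥ k, and at a level where ≈ is
-- stable on all pairs of nodes it is a bisimulation.

open import Defs
open import Data.Bool using (true; false; T; if_then_else_)
open import Data.Bool.Properties using (T-≡; T-∧)
open import Data.Empty using (⊥-elim)
open import Data.Fin using (Fin; toℕ) renaming (zero to fzero; suc to fsuc)
open import Data.Fin.Properties using (toℕ-injective; injective⇒≤; any?; all?)
open import Data.List using (List; []; _∷_; map; upTo; allFin; length)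
open import Data.List.Membership.Propositional using (_∈_; lose)
open import Data.List.Membership.Propositional.Properties using (∈-upTo⁺; ∈-allFin)
open import Data.List.Properties using (length-tabulate)
open import Data.List.Relation.Unary.Any using (satisfied) renaming (here to here∈; there to there∈)
open import Data.List.Relation.Unary.Any.Properties using (any⁺; any⁻; tabulate⁺)
open import Data.Nat using (ℕ; zero; suc; _+_; _*_; _^_; _≤_; _<_; z≤n; s≤s; _≤?_)
open import Data.Nat.ListAction using (sum)
open import Data.Nat.Properties
open import Algebra.Properties.CommutativeSemigroup +-commutativeSemigroup using (interchange)
open import Data.Nat.Solver using (module +-*-Solver)
open import Data.Product using (Σ; ∃; _×_; _,_; proj₁; proj₂)
open import Data.Sum using (_⊎_; inj₁; inj₂)
open import Data.Unit using (tt)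
open import Function using (_∘_; Equivalence)
open import Relation.Binary.PropositionalEquality using (_≡_; _≢_; refl; sym; cong; subst; module ≡-Reasoning)
open import Relation.Nullary using (¬_; Dec; yes; no; _because_)
open import Relation.Nullary.Decidable
  using (map′; _×-dec_; _→-dec_; ¬?; decidable-stable; toWitness; fromWitness)
open import Relation.Nullary.Reflects using (Reflects; ofʸ; ofⁿ; fromEquivalence)

n<2^n : ∀ m → m < 2 ^ m
n<2^n zero    = s≤s z≤n
n<2^n (suc m) =
  +-mono-≤ (^-monoʳ-≤ 2 {0} {m} z≤n) (≤-trans (n<2^n m) (≤-reflexive (sym (+-identityʳ _))))

square-double : ∀ c → 2 * (2 * c ^ 2) ≡ (c + c) ^ 2
square-double = solve 1 (λ c → con 2 :* (con 2 :* c :^ 2) := (c :+ c) :^ 2) refl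
  where open +-*-Solver

2^≤square-double : ∀ {m c s} → 2 ^ m ≤ c ^ 2 → c + c ≤ s → 2 ^ (2 + m) ≤ s ^ 2
2^≤square-double {m} {c} {s} 2^m≤c² c+c≤s = begin
  2 * (2 * 2 ^ m)  ≤⟨ *-monoʳ-≤ 2 (*-monoʳ-≤ 2 2^m≤c²) ⟩
  2 * (2 * c ^ 2)  ≡⟨ square-double c ⟩
  (c + c) ^ 2      ≤⟨ ^-monoˡ-≤ 2 c+c≤s ⟩
  s ^ 2            ∎
  where open ≤-Reasoning

2^≤square-+ : ∀ {m a b} → 2 ^ m ≤ a ^ 2 → 2 ^ m ≤ b ^ 2 → 2 ^ (2 + m) ≤ (a + b) ^ 2
2^≤square-+ {m} {a} {b} 2^m≤a² 2^m≤b² with ≤-total a b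
... | inj₁ a≤b = 2^≤square-double {m} {a} 2^m≤a² (+-monoʳ-≤ a a≤b)
... | inj₂ b≤a = 2^≤square-double {m} {b} 2^m≤b² (+-monoˡ-≤ b b≤a)

2^≤square-of-sums : ∀ {m} a b c d {s t} → 2 ^ m ≤ (a + b) ^ 2 → 2 ^ m ≤ (c + d) ^ 2 →
                    a + c ≤ s → b + d ≤ t → 2 ^ (2 + m) ≤ (s + t) ^ 2
2^≤square-of-sums {m} a b c d {s} {t} 2^m≤[a+b]² 2^m≤[c+d]² a+c≤s b+d≤t = begin
  2 ^ (2 + m)                ≤⟨ 2^≤square-+ {m} {a + b} {c + d} 2^m≤[a+b]² 2^m≤[c+d]² ⟩
  ((a + b) + (c + d)) ^ 2    ≡⟨ cong (_^ 2) (interchange a b c d) ⟩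
  ((a + c) + (b + d)) ^ 2    ≤⟨ ^-monoˡ-≤ 2 (+-mono-≤ a+c≤s b+d≤t) ⟩
  (s + t) ^ 2                ∎
  where open ≤-Reasoning

module _ {A : Set} where

  sum-map-mono : ∀ {f g : A → ℕ} (xs : List A) → (∀ x → f x ≤ g x) →
                 sum (map f xs) ≤ sum (map g xs)
  sum-map-mono []       f≤g = z≤n
  sum-map-mono (x ∷ xs) f≤g = +-mono-≤ (f≤g x) (sum-map-mono xs f≤g)

  sum-map-+ : ∀ (f g : A → ℕ) (xs : List A) →
              sum (map (λ x → f x + g x) xs) ≡ sum (map f xs) + sum (map g xs)
  sum-map-+ f g []       = refl
  sum-map-+ f g (x ∷ xs) = begin
    (f x + g x) + sum (map (λ x → f x + g x) xs)    ≡⟨ cong (f x + g x +_) (sum-map-+ f g xs) ⟩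
    (f x + g x) + (sum (map f xs) + sum (map g xs)) ≡⟨ interchange (f x) (g x) _ _ ⟩
    (f x + sum (map f xs)) + (g x + sum (map g xs)) ∎
    where open ≡-Reasoning

  sum-map-≤-length : ∀ {f : A → ℕ} (xs : List A) → (∀ x → f x ≤ 1) → sum (map f xs) ≤ length xs
  sum-map-≤-length []       f≤1 = z≤n
  sum-map-≤-length (x ∷ xs) f≤1 = +-mono-≤ (f≤1 x) (sum-map-≤-length xs f≤1)

  ∈⇒≤-sum-map : ∀ (f : A → ℕ) {x xs} → x ∈ xs → f x ≤ sum (map f xs)
  ∈⇒≤-sum-map f {xs = y ∷ xs} (here∈ refl) = m≤m+n (f y) _
  ∈⇒≤-sum-map f {xs = y ∷ xs} (there∈ x∈xs) = ≤-trans (∈⇒≤-sum-map f x∈xs) (m≤n+m _ (f y))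

module _ {n : ℕ} (adj : Adj n) where

  infix 4 _─[_]→_ _≈[_]_

  _─[_]→_ : Fin n → ℕ → Fin n → Set
  u ─[ d ]→ w = Path adj d u w

  _≈[_]_ : Fin n → ℕ → Fin n → Set
  u ≈[ k ] v = Approx adj k u v

  ∣_∣ : Fin n → ℕ
  ∣ u ∣ = size adj u

  infixr 5 _++ᵖ_
  _++ᵖ_ : ∀ {a b u v w} → u ─[ a ]→ v → v ─[ b ]→ w → u ─[ a + b ]→ w
  here     ++ᵖ q = q
  step e p ++ᵖ q = step e (p ++ᵖ q)

  Path-unsnoc : ∀ {d u w} → u ─[ suc d ]→ w → Σ (Fin n) λ x → u ─[ d ]→ x × Edge adj x w
  Path-unsnoc (step e here)         = _ , here , e
  Path-unsnoc (step e (step e′ p)) with Path-unsnoc (step e′ p)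
  ... | x , q , x→w = x , step e q , x→w

  Path-1⇒Edge : ∀ {u w} → u ─[ 1 ]→ w → Edge adj u w
  Path-1⇒Edge (step e here) = e

  pathB-sound : ∀ d {u w} → T (pathB adj d u w) → u ─[ d ]→ w
  pathB-sound zero    t with toWitness t
  ... | refl = here
  pathB-sound (suc d) t with satisfied (any⁻ _ (allFin n) t)
  ... | x , t′ with Equivalence.to T-∧ t′
  ... | u→x , x→w = step (Equivalence.to T-≡ u→x) (pathB-sound d x→w)

  pathB-complete : ∀ {d u w} → u ─[ d ]→ w → T (pathB adj d u w)
  pathB-complete here               = fromWitness refl
  pathB-complete (step {x = x} e p) =
    any⁺ _ (tabulate⁺ x (Equivalence.from T-∧ (Equivalence.from T-≡ e , pathB-complete p)))

  path? : ∀ d u w → Dec (u ─[ d ]→ w)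
  path? d u w = pathB adj d u w because fromEquivalence (pathB-sound d) pathB-complete

  Approx-pred : ∀ {k u v} → u ≈[ suc k ] v → u ≈[ k ] v
  Approx-pred {zero}  _           = tt
  Approx-pred {suc k} (fwd , bwd) =
    (λ d x p → let (y , q , x≈y) = fwd d x p in y , q , Approx-pred x≈y) ,
    (λ d y q → let (x , p , x≈y) = bwd d y q in x , p , Approx-pred x≈y)

  Approx-sym : ∀ {k u v} → u ≈[ k ] v → v ≈[ k ] u
  Approx-sym {zero}  _           = tt
  Approx-sym {suc k} (fwd , bwd) =
    (λ d y q → let (x , p , x≈y) = bwd d y q in x , p , Approx-sym x≈y) ,
    (λ d x p → let (y , q , x≈y) = fwd d x p in y , q , Approx-sym x≈y)

  Approx-trans : ∀ {k u v w} → u ≈[ k ] v → v ≈[ k ] w → u ≈[ k ] w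
  Approx-trans {zero}  _           _             = tt
  Approx-trans {suc k} (fwd , bwd) (fwd′ , bwd′) =
    (λ d x p → let (y , q , x≈y) = fwd d x p ; (z , r , y≈z) = fwd′ d y q
               in z , r , Approx-trans x≈y y≈z) ,
    (λ d z r → let (y , q , y≈z) = bwd′ d z r ; (x , p , x≈y) = bwd d y q
               in x , p , Approx-trans x≈y y≈z)

  Approx-stable⇒Bisimilar : ∀ N → (∀ x y → x ≈[ N ] y → x ≈[ suc N ] y) →
                            ∀ {u v} → u ≈[ suc N ] v → Bisimilar adj u v
  Approx-stable⇒Bisimilar N stable u≈v = (_≈[ suc N ]_) , u≈v , λ x y (fwd , bwd) →
    (λ x′ x→x′ → let (y′ , y─→y′ , x′≈y′) = fwd 1 x′ (step x→x′ here)
                 in y′ , Path-1⇒Edge y─→y′ , stable x′ y′ x′≈y′) ,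
    (λ y′ y→y′ → let (x′ , x─→x′ , x′≈y′) = bwd 1 y′ (step y→y′ here)
                 in x′ , Path-1⇒Edge x─→x′ , stable x′ y′ x′≈y′)

  Rank : ℕ → Fin n → Fin n → Set
  Rank m u v = u ≈[ m ] v × ¬ u ≈[ suc m ] v

  Rank-sym : ∀ {m u v} → Rank m u v → Rank m v u
  Rank-sym (u≈v , u≉v) = Approx-sym u≈v , u≉v ∘ Approx-sym

  Rank-transfer : ∀ {m p q o z} → p ≈[ suc m ] z → o ≈[ suc m ] q → Rank m p q → Rank m o z
  Rank-transfer p≈z o≈q (p≈q , p≉q) =
    Approx-trans (Approx-pred o≈q) (Approx-trans (Approx-sym p≈q) (Approx-pred p≈z)) ,
    λ o≈z → p≉q (Approx-trans p≈z (Approx-trans (Approx-sym o≈z) o≈q))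

  Rank-≢ : ∀ {m p q o} → Rank m p q → o ≈[ suc m ] q → p ≢ o
  Rank-≢ (_ , p≉q) o≈q refl = p≉q o≈q

  Below : (Fin n → Fin n → Set) → Fin n → Fin n → Set
  Below R u v = Σ ℕ λ D → Σ (Fin n) λ p → Σ (Fin n) λ q → u ─[ D ]→ p × v ─[ D ]→ q × R p q

  Below-bind : ∀ {R S : Fin n → Fin n → Set} {u v} →
               (∀ {p q} → R p q → Below S p q) → Below R u v → Below S u v
  Below-bind f (D , p , q , u→p , v→q , Rpq) with f Rpq
  ... | E , p′ , q′ , p→p′ , q→q′ , Sp′q′ =
    D + E , p′ , q′ , u→p ++ᵖ p→p′ , v→q ++ᵖ q→q′ , Sp′q′

  Below-sym : ∀ {R : Fin n → Fin n → Set} {u v} →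
              (∀ {p q} → R p q → R q p) → Below R u v → Below R v u
  Below-sym sym (D , p , q , u→p , v→q , Rpq) = D , q , p , v→q , u→p , sym Rpq

  Unmatched : ℕ → Fin n → Fin n → Set
  Unmatched j a b = Σ ℕ λ d → Σ (Fin n) λ x → a ─[ d ]→ x × (∀ y → b ─[ d ]→ y → ¬ x ≈[ j ] y)

  Unmatched⇒¬Approx-suc : ∀ {j a b} → Unmatched j a b → ¬ a ≈[ suc j ] b
  Unmatched⇒¬Approx-suc (d , x , a→x , x≉) (fwd , _) =
    let (y , b→y , x≈y) = fwd d x a→x in x≉ y b→y x≈y

  ¬Unmatched⇒Approx-suc : ∀ {j a b} → (∀ x y → Dec (x ≈[ j ] y)) →
                          ¬ Unmatched j a b → ¬ Unmatched j b a → a ≈[ suc j ] b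
  ¬Unmatched⇒Approx-suc {j} approx? ¬uab ¬uba =
    matched ¬uab ,
    λ d y b→y → let (x , a→x , y≈x) = matched ¬uba d y b→y in x , a→x , Approx-sym y≈x
    where
    matched : ∀ {a b} → ¬ Unmatched j a b →
              ∀ d x → a ─[ d ]→ x → Σ (Fin n) λ y → b ─[ d ]→ y × x ≈[ j ] y
    matched {b = b} ¬u d x a→x = decidable-stable (any? λ y → path? d b y ×-dec approx? x y)
      λ ¬match → ¬u (d , x , a→x , λ y b→y x≈y → ¬match (y , b→y , x≈y))

  Unmatched⇒Rank-below : ∀ {m u v} → u ≈[ suc m ] v → Unmatched (suc m) u v → Below (Rank m) u v
  Unmatched⇒Rank-below (fwd , _) (d , x , u→x , x≉) =
    let (y , v→y , x≈y) = fwd d x u→x in d , x , y , u→x , v→y , x≈y , x≉ y v→y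

  module _ {root : Fin n} (tree : IsRootedTree adj root) where
    open IsRootedTree tree

    -- A cycle through t rotates to a cycle through the parent of t; the root has none.
    no-cycle-below : ∀ c {t b} → root ─[ c ]→ t → ¬ t ─[ suc b ]→ t
    no-cycle-below zero    here cycle = root-no-parent _ (proj₂ (proj₂ (Path-unsnoc cycle)))
    no-cycle-below (suc c) r→t cycle with Path-unsnoc r→t | Path-unsnoc cycle
    ... | s , r→s , s→t | s′ , t→s′ , s′→t with parent-unique _ s s′ s→t s′→t
    ... | refl = no-cycle-below c r→s (step s→t t→s′)

    no-cycle : ∀ {t b} → ¬ t ─[ suc b ]→ t
    no-cycle {t} = no-cycle-below _ (proj₂ (reachable t))

    path-length-unique : ∀ {a b s w} → s ─[ a ]→ w → s ─[ b ]→ w → a ≡ b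
    path-length-unique {zero}  {zero}  _    _    = refl
    path-length-unique {zero}  {suc b} here q    = ⊥-elim (no-cycle q)
    path-length-unique {suc a} {zero}  p    here = ⊥-elim (no-cycle p)
    path-length-unique {suc a} {suc b} p    q    with Path-unsnoc p | Path-unsnoc q
    ... | x , p′ , x→w | y , q′ , y→w with parent-unique _ x y x→w y→w
    ... | refl = cong suc (path-length-unique p′ q′)

    path-source-unique : ∀ {a s t w} → s ─[ a ]→ w → t ─[ a ]→ w → s ≡ t
    path-source-unique {zero}  here here = refl
    path-source-unique {suc a} p    q    with Path-unsnoc p | Path-unsnoc q
    ... | x , p′ , x→w | y , q′ , y→w with parent-unique _ x y x→w y→w
    ... | refl = path-source-unique p′ q′

    Path-prefix : ∀ {d u w} → u ─[ d ]→ w → (i : Fin (suc d)) → Σ (Fin n) λ x → u ─[ toℕ i ]→ x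
    Path-prefix p          fzero    = _ , here
    Path-prefix (step e p) (fsuc i) = let (x , u→x) = Path-prefix p i in x , step e u→x

    path-length<n : ∀ {d u w} → u ─[ d ]→ w → d < n
    path-length<n {u = u} p = injective⇒≤ λ {i} {j} pᵢ≡pⱼ →
      toℕ-injective (path-length-unique (proj₂ (Path-prefix p i))
        (subst (u ─[ toℕ j ]→_) (sym pᵢ≡pⱼ) (proj₂ (Path-prefix p j))))

    subtrees-disjoint : ∀ {D a b u p o w} → u ─[ D ]→ p → u ─[ D ]→ o →
                        p ─[ a ]→ w → o ─[ b ]→ w → p ≡ o
    subtrees-disjoint {D} {a} {b} {o = o} {w} u→p u→o p→w o→w = path-source-unique p→w o→w′
      where
      o→w′ : o ─[ a ]→ w
      o→w′ = subst (o ─[_]→ w)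
               (sym (+-cancelˡ-≡ D a b (path-length-unique (u→p ++ᵖ p→w) (u→o ++ᵖ o→w)))) o→w

    descB-reflects : ∀ {u w} → Reflects (∃ λ d → u ─[ d ]→ w) (descB adj u w)
    descB-reflects {u} {w} = fromEquivalence sound complete
      where
      sound : T (descB adj u w) → ∃ λ d → u ─[ d ]→ w
      sound t = let (d , t′) = satisfied (any⁻ _ (upTo n) t) in d , pathB-sound d t′
      complete : (∃ λ d → u ─[ d ]→ w) → T (descB adj u w)
      complete (d , u→w) = any⁺ _ (lose (∈-upTo⁺ (path-length<n u→w)) (pathB-complete u→w))

    inSubtree : Fin n → Fin n → ℕ
    inSubtree u w = if descB adj u w then 1 else 0

    inSubtree≤1 : ∀ u w → inSubtree u w ≤ 1
    inSubtree≤1 u w with descB adj u w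
    ... | true  = ≤-refl
    ... | false = z≤n

    inSubtree≡1 : ∀ {d u w} → u ─[ d ]→ w → inSubtree u w ≡ 1
    inSubtree≡1 {u = u} {w} u→w with descB adj u w | descB-reflects {u} {w}
    ... | true  | _         = refl
    ... | false | ofⁿ ¬u→*w = ⊥-elim (¬u→*w (_ , u→w))

    inSubtree-disjoint : ∀ {D u p o} → u ─[ D ]→ p → u ─[ D ]→ o → p ≢ o →
                         ∀ w → inSubtree p w + inSubtree o w ≤ inSubtree u w
    inSubtree-disjoint {p = p} {o} u→p u→o p≢o w
      with descB adj p w | descB-reflects {p} {w} | descB adj o w | descB-reflects {o} {w}
    ... | true  | ofʸ (_ , p→w) | true  | ofʸ (_ , o→w) =
      ⊥-elim (p≢o (subtrees-disjoint u→p u→o p→w o→w))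
    ... | true  | ofʸ (_ , p→w) | false | _             = ≤-reflexive (sym (inSubtree≡1 (u→p ++ᵖ p→w)))
    ... | false | _             | true  | ofʸ (_ , o→w) = ≤-reflexive (sym (inSubtree≡1 (u→o ++ᵖ o→w)))
    ... | false | _             | false | _             = z≤n

    size≥1 : ∀ u → 1 ≤ ∣ u ∣
    size≥1 u = subst (_≤ ∣ u ∣) (inSubtree≡1 here) (∈⇒≤-sum-map (inSubtree u) (∈-allFin u))

    size≤n : ∀ u → ∣ u ∣ ≤ n
    size≤n u = ≤-trans (sum-map-≤-length (allFin n) (inSubtree≤1 u))
                       (≤-reflexive (length-tabulate {n = n} (λ i → i)))

    size-disjoint : ∀ {D u p o} → u ─[ D ]→ p → u ─[ D ]→ o → p ≢ o → ∣ p ∣ + ∣ o ∣ ≤ ∣ u ∣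
    size-disjoint {u = u} {p} {o} u→p u→o p≢o = begin
      ∣ p ∣ + ∣ o ∣
        ≡⟨ sum-map-+ (inSubtree p) (inSubtree o) (allFin n) ⟨
      sum (map (λ w → inSubtree p w + inSubtree o w) (allFin n))
        ≤⟨ sum-map-mono (allFin n) (inSubtree-disjoint u→p u→o p≢o) ⟩
      ∣ u ∣
        ∎
      where open ≤-Reasoning

    4≤[size+size]² : ∀ u v → 4 ≤ (∣ u ∣ + ∣ v ∣) ^ 2
    4≤[size+size]² u v = ^-monoˡ-≤ 2 (+-mono-≤ (size≥1 u) (size≥1 v))

    -- The depth of a path is below n, so the depth quantifier ranges over a finite set.
    unmatched? : ∀ {j} → (∀ x y → Dec (x ≈[ j ] y)) → ∀ a b → Dec (Unmatched j a b)
    unmatched? approx? a b =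
      map′ (λ (d , _ , x , a→x , x≉) → d , x , a→x , x≉)
           (λ (d , x , a→x , x≉) → d , path-length<n a→x , x , a→x , x≉)
           (anyUpTo? (λ d → any? λ x → path? d a x ×-dec
                                all? λ y → path? d b y →-dec ¬? (approx? x y)) n)

    approx? : ∀ k x y → Dec (x ≈[ k ] y)
    approx? zero    _ _ = yes tt
    approx? (suc k) a b with unmatched? (approx? k) a b | unmatched? (approx? k) b a
    ... | yes uab | _       = no (Unmatched⇒¬Approx-suc uab)
    ... | no _    | yes uba = no (Unmatched⇒¬Approx-suc uba ∘ Approx-sym)
    ... | no ¬uab | no ¬uba = yes (¬Unmatched⇒Approx-suc (approx? k) ¬uab ¬uba)

    ¬Approx-suc⇒Unmatched : ∀ {j a b} → ¬ a ≈[ suc j ] b → Unmatched j a b ⊎ Unmatched j b a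
    ¬Approx-suc⇒Unmatched {j} {a} {b} a≉b
      with unmatched? (approx? j) a b | unmatched? (approx? j) b a
    ... | yes uab | _       = inj₁ uab
    ... | no _    | yes uba = inj₂ uba
    ... | no ¬uab | no ¬uba = ⊥-elim (a≉b (¬Unmatched⇒Approx-suc (approx? j) ¬uab ¬uba))

    Rank-suc-below : ∀ {m u v} → Rank (suc m) u v → Below (Rank m) u v
    Rank-suc-below (u≈v , u≉v) with ¬Approx-suc⇒Unmatched u≉v
    ... | inj₁ uv = Unmatched⇒Rank-below u≈v uv
    ... | inj₂ vu = Below-sym Rank-sym (Unmatched⇒Rank-below (Approx-sym u≈v) vu)

    Rank-bound-step : ∀ {m u v} → (∀ {p q} → Rank m p q → 2 ^ m ≤ (∣ p ∣ + ∣ q ∣) ^ 2) →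
                      u ≈[ 2 + m ] v → Below (Rank m) u v → 2 ^ (2 + m) ≤ (∣ u ∣ + ∣ v ∣) ^ 2
    Rank-bound-step {m} bound (fwd , bwd) (D , p , q , u→p , v→q , p∼q) =
      let (z , v→z , p≈z) = fwd D p u→p
          (o , u→o , o≈q) = bwd D q v→q
      in 2^≤square-of-sums {m} (∣ p ∣) (∣ q ∣) (∣ o ∣) (∣ z ∣)
           (bound p∼q) (bound (Rank-transfer p≈z o≈q p∼q))
           (size-disjoint u→p u→o (Rank-≢ p∼q o≈q))
           (size-disjoint v→q v→z (Rank-≢ (Rank-sym p∼q) (Approx-sym p≈z)))

    Rank-bound : ∀ m {u v} → Rank m u v → 2 ^ m ≤ (∣ u ∣ + ∣ v ∣) ^ 2
    Rank-bound zero          {u} {v} _ = ≤-trans (s≤s z≤n) (4≤[size+size]² u v)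
    Rank-bound (suc zero)    {u} {v} _ = ≤-trans (s≤s (s≤s z≤n)) (4≤[size+size]² u v)
    Rank-bound (suc (suc m)) r@(u≈v , _) =
      Rank-bound-step (Rank-bound m) u≈v (Below-bind Rank-suc-below (Rank-suc-below r))

    Approx-lift : ∀ {m x y} → x ≈[ m ] y → (∣ x ∣ + ∣ y ∣) ^ 2 < 2 ^ m → x ≈[ suc m ] y
    Approx-lift {m} {x} {y} x≈y small =
      decidable-stable (approx? (suc m) x y) λ x≉y → <⇒≱ small (Rank-bound m (x≈y , x≉y))

    Approx-climb : ∀ i {k u v} → u ≈[ k ] v → (∣ u ∣ + ∣ v ∣) ^ 2 < 2 ^ k → u ≈[ i + k ] v
    Approx-climb zero        u≈v small = u≈v
    Approx-climb (suc i) {k} u≈v small =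
      Approx-lift (Approx-climb i u≈v small) (<-≤-trans small (^-monoʳ-≤ 2 (m≤n+m k i)))

    Approx-stable : ∀ {m} → (n + n) ^ 2 ≤ m → ∀ x y → x ≈[ m ] y → x ≈[ suc m ] y
    Approx-stable {m} [n+n]²≤m x y x≈y = Approx-lift x≈y (begin-strict
      (∣ x ∣ + ∣ y ∣) ^ 2  ≤⟨ ^-monoˡ-≤ 2 (+-mono-≤ (size≤n x) (size≤n y)) ⟩
      (n + n) ^ 2          ≤⟨ [n+n]²≤m ⟩
      m                    <⟨ n<2^n m ⟩
      2 ^ m                ∎)
      where open ≤-Reasoning

proposition3p10 : (n : ℕ) (adj : Adj n) (root : Fin n) → IsRootedTree adj root →
    (u₀ v₀ : Fin n) → ¬ Bisimilar adj u₀ v₀ →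
    (k : ℕ) → Approx adj k u₀ v₀ →
    2 ^ k ≤ (size adj u₀ + size adj v₀) ^ 2
proposition3p10 n adj root tree u₀ v₀ ¬bisim k u₀≈v₀ =
  decidable-stable (2 ^ k ≤? (size adj u₀ + size adj v₀) ^ 2) λ 2^k≰ →
    ¬bisim (Approx-stable⇒Bisimilar adj (M + k) (Approx-stable adj tree (m≤m+n M k))
             (Approx-climb adj tree (suc M) u₀≈v₀ (≰⇒> 2^k≰)))
  where
  M : ℕ
  M = (n + n) ^ 2
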